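{- For every integer $k>0$, the graph $P_{3k-1} * v$ contains a subdivision of $S_{3,k}$. In particular, for every integer $\ell>0$, the wall $W_\ell$ is a strong immersion minor of $P_{6\ell^2-1} * v$.
   Context: Graphs may have parallel edges but no loops. $P_n$ denotes the path of length $n$ (with $n$ edges), and $P_n * v$ is the graph obtained from $P_n$ by adding a new vertex $v$ adjacent (by one edge each) to every vertex of $P_n$. For integers $k,n>0$, $S_{k,n}$ is the graph on vertices $x,v_1,\dots,v_n$ with exactly $k$ parallel edges joining $x$ and $v_i$ for each $i$, and no other edges. A strong immersion of $H$ in $G$ is a map sending $V(H)$ injectively into $V(G)$ and each edge $uv$ of $H$ to a path between the images of $u,v$, with these paths pairwise edge-disjoint and having no internal vertices among the images of $V(H)$. The wall $W_\ell$: start from the grid with vertex set $\{1,\dots,\ell\}\times\{1,\dots,2\ell\}$ in which $(i,j)$ is adjacent to $(i,j+1)$ and to $(i+1,j)$; delete every edge $(i,j)(i+1,j)$ with $j \equiv i+1 \pmod 2$, and then delete the two resulting vertices of degree $1$. -}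

module Defs where

open import Level using (0ℓ)
open import Data.Nat using (ℕ; zero; suc; _+_; _*_; _∸_; _<_; _%_; _≡ᵇ_; _<ᵇ_; _≤ᵇ_)
open import Data.Bool using (Bool; true; false; _∧_; not; T)
open import Data.Fin using (Fin; toℕ; inject₁; fromℕ) renaming (zero to fz; suc to fs)
open import Data.Maybe using (Maybe; just; nothing)
open import Data.Product using (Σ; _×_; _,_; proj₁; proj₂)
open import Data.Sum using (_⊎_; inj₁; inj₂)
open import Relation.Binary.PropositionalEquality using (_≡_; _≢_)

-- Parallel edges are distinct elements of E with equal ends.
-- (All concrete graphs below are loopless by construction.)

record Graph : Set₁ where
  field
    V    : Set
    E    : Set
    ends : E → V × V
open Graph public

Joins : (G : Graph) → E G → V G → V G → Set
Joins G e a b = ends G e ≡ (a , b) ⊎ ends G e ≡ (b , a)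

record Path (G : Graph) (u w : V G) : Set where
  field
    len   : ℕ
    vert  : Fin (suc len) → V G
    edge  : Fin len → E G
    start : vert fz ≡ u
    stop  : vert (fromℕ len) ≡ w
    vinj  : ∀ i j → vert i ≡ vert j → i ≡ j
    link  : ∀ i → Joins G (edge i) (vert (inject₁ i)) (vert (fs i))
open Path public

Internal : ∀ {G u w} (P : Path G u w) → Fin (suc (len P)) → Set
Internal P i = 0 < toℕ i × toℕ i < len P

record PathSystem (H G : Graph) : Set where
  field
    φ        : V H → V G
    φ-inj    : ∀ x y → φ x ≡ φ y → x ≡ y
    path     : (f : E H) → Path G (φ (proj₁ (ends H f))) (φ (proj₂ (ends H f)))
    edisj    : ∀ f f' → f ≢ f' → ∀ i j → edge (path f) i ≢ edge (path f') j
    avoid    : ∀ f i x → Internal (path f) i → vert (path f) i ≢ φ x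
open PathSystem public

StrongImmersion : Graph → Graph → Set
StrongImmersion H G = PathSystem H G

record Subdivision (H G : Graph) : Set where
  field
    system : PathSystem H G
    idisj  : ∀ f f' → f ≢ f' → ∀ i j →
             Internal (path system f) i → Internal (path system f') j →
             vert (path system f) i ≢ vert (path system f') j
open Subdivision public

-- P n * v : path on vertices just 0 .. just n (n edges) plus apex nothing.
PathApex : ℕ → Graph
PathApex n = record
  { V = Maybe (Fin (suc n))
  ; E = Fin n ⊎ Fin (suc n)
  ; ends = λ { (inj₁ i) → just (inject₁ i) , just (fs i)
             ; (inj₂ i) → just i , nothing } }

-- S k n : centre x = nothing, leaves just i, k parallel edges x – v_i.
S : ℕ → ℕ → Graph
S k n = record
  { V = Maybe (Fin n)
  ; E = Fin n × Fin k
  ; ends = λ e → nothing , just (proj₁ e) }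

-- Wall W ℓ.  Grid vertices (i , j), 1 ≤ i ≤ ℓ, 1 ≤ j ≤ 2ℓ.
-- The vertical edge (i,j)(i+1,j) is kept iff j ≢ i+1 (mod 2), i.e. iff
-- j % 2 ≡ i % 2.
vkeep : ℕ → ℕ → Bool
vkeep i j = (j % 2) ≡ᵇ (i % 2)

inGrid : ℕ → ℕ → ℕ → Bool
inGrid ℓ i j = (1 ≤ᵇ i) ∧ (i ≤ᵇ ℓ) ∧ (1 ≤ᵇ j) ∧ (j ≤ᵇ (2 * ℓ))

b2n : Bool → ℕ
b2n true  = 1
b2n false = 0

gdeg : ℕ → ℕ → ℕ → ℕ
gdeg ℓ i j = b2n (1 <ᵇ j) + b2n (j <ᵇ (2 * ℓ))
           + b2n ((1 <ᵇ i) ∧ vkeep (i ∸ 1) j) + b2n ((i <ᵇ ℓ) ∧ vkeep i j)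

WV : ℕ → Set
WV ℓ = Σ (ℕ × ℕ) λ p → T (inGrid ℓ (proj₁ p) (proj₂ p) ∧ not (gdeg ℓ (proj₁ p) (proj₂ p) ≡ᵇ 1))

WAdj : ∀ {ℓ} → WV ℓ → WV ℓ → Set
WAdj ((i , j) , _) ((i' , j') , _) =
  (i' ≡ i × j' ≡ suc j) ⊎ (i' ≡ suc i × j' ≡ j × T (vkeep i j))

Wall : ℕ → Graph
Wall ℓ = record
  { V = WV ℓ
  ; E = Σ (WV ℓ × WV ℓ) λ p → WAdj (proj₁ p) (proj₂ p)
  ; ends = proj₁ }

module Submission where

-- Number the spine of P_{3K-1} * v by 0, …, 3K−1 and cut it into K blocks
-- {3a, 3a+1, 3a+2}; each branch vertex sits in the middle 3a+1 of its own block.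
-- For S_{3,k} the three legs from the apex v to 3a+1 are the edge v(3a+1) and the
-- paths v(3a)(3a+1) and v(3a+2)(3a+1), all inside block a, so distinct legs share
-- neither edges nor interior vertices.  For the wall W_ℓ, give the vertex in row i and
-- column j the block d = 2ℓ(i−1) + (j−1) < 2ℓ².  A horizontal edge joins consecutive
-- blocks d, d+1 and is routed along the spine 3d+1, 3d+2, 3d+3, 3d+4; a vertical edge
-- is routed through the apex.  Each apex edge v(3d+1) is used at most once, because
-- the parity rule deleting vertical edges leaves every wall vertex with at most one
-- vertical neighbour.  Finally 3 · 2ℓ² = 6ℓ².

open import Defs
open import Data.Bool using (T)
open import Data.Bool.Properties using (T-∧; T-irrelevant)
open import Data.Fin using (Fin; toℕ; fromℕ<; inject₁) renaming (zero to fz; suc to fs)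
open import Data.Fin.Properties using (toℕ-injective; toℕ-fromℕ; toℕ-fromℕ<; toℕ-inject₁; toℕ<n)
open import Data.Maybe as Maybe using (Maybe; just; nothing)
open import Data.Maybe.Properties using (just-injective)
open import Data.Nat using (ℕ; suc; pred; _+_; _*_; _∸_; _⊓_; _<_; _≤_; z≤n; s≤s; NonZero; >-nonZero)
open import Data.Nat.DivMod using (_%_; [m+kn]%n≡m%n; m<n⇒m%n≡m)
open import Data.Nat.Properties
open import Data.Nat.Tactic.RingSolver using (solve-∀)
open import Data.Product using (_×_; _,_; proj₁; proj₂)
open import Data.Sum as Sum using (_⊎_; inj₁; inj₂; swap)
open import Data.Sum.Properties using (inj₁-injective; inj₂-injective)
open import Function using (_∘_)
open import Function.Bundles using (Equivalence)
open import Relation.Nullary using (¬_; contradiction)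
open import Relation.Binary.PropositionalEquality

images-≡ : ∀ {A B : Set} (f : A → B) {u v x y} → f u ≡ x → f v ≡ y → u ≡ v → x ≡ y
images-≡ f fu≡x fv≡y u≡v = trans (sym fu≡x) (trans (cong f u≡v) fv≡y)

digits-< : ∀ {M a b A} → a < A → b < M → b + a * M < A * M
digits-< {M} {a} {b} {A} a<A b<M = begin-strict
  b + a * M  <⟨ +-monoˡ-< (a * M) b<M ⟩
  suc a * M  ≤⟨ *-monoˡ-≤ M a<A ⟩
  A * M      ∎
  where open ≤-Reasoning

digits-injective : ∀ {M a b c d} → b < M → d < M → b + a * M ≡ d + c * M → a ≡ c × b ≡ d
digits-injective {M} {a} {b} {c} {d} b<M d<M eq =
  *-cancelʳ-≡ a c M (+-cancelˡ-≡ b (a * M) (c * M) (trans eq (cong (_+ c * M) (sym b≡d)))) , b≡d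
  where
  instance
    M≢0 : NonZero M
    M≢0 = >-nonZero (≤-<-trans z≤n b<M)
  low-digit : ∀ x {y} → y < M → (y + x * M) % M ≡ y
  low-digit x {y} y<M = trans ([m+kn]%n≡m%n y x M) (m<n⇒m%n≡m y<M)
  b≡d : b ≡ d
  b≡d = trans (sym (low-digit a b<M)) (trans (cong (_% M) eq) (low-digit c d<M))

module _ {G : Graph} where

  edgePath : ∀ {a b} e → a ≢ b → Joins G e a b → Path G a b
  edgePath {a} {b} e a≢b joins = record
    { len = 1 ; vert = vert′ ; edge = λ _ → e ; start = refl ; stop = refl
    ; vinj = vinj′ ; link = λ { fz → joins } }
    where
    vert′ : Fin 2 → V G
    vert′ fz = a
    vert′ (fs fz) = b
    vinj′ : ∀ i j → vert′ i ≡ vert′ j → i ≡ j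
    vinj′ fz fz _ = refl
    vinj′ fz (fs fz) eq = contradiction eq a≢b
    vinj′ (fs fz) fz eq = contradiction (sym eq) a≢b
    vinj′ (fs fz) (fs fz) _ = refl

  twoEdgePath : ∀ {a c} b e e′ → a ≢ b → a ≢ c → b ≢ c →
                Joins G e a b → Joins G e′ b c → Path G a c
  twoEdgePath {a} {c} b e e′ a≢b a≢c b≢c joins joins′ = record
    { len = 2 ; vert = vert′ ; edge = edge′ ; start = refl ; stop = refl
    ; vinj = vinj′ ; link = λ { fz → joins ; (fs fz) → joins′ } }
    where
    vert′ : Fin 3 → V G
    vert′ fz = a
    vert′ (fs fz) = b
    vert′ (fs (fs fz)) = c
    edge′ : Fin 2 → E G
    edge′ fz = e
    edge′ (fs fz) = e′
    vinj′ : ∀ i j → vert′ i ≡ vert′ j → i ≡ j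
    vinj′ fz fz _ = refl
    vinj′ fz (fs fz) eq = contradiction eq a≢b
    vinj′ fz (fs (fs fz)) eq = contradiction eq a≢c
    vinj′ (fs fz) fz eq = contradiction (sym eq) a≢b
    vinj′ (fs fz) (fs fz) _ = refl
    vinj′ (fs fz) (fs (fs fz)) eq = contradiction eq b≢c
    vinj′ (fs (fs fz)) fz eq = contradiction (sym eq) a≢c
    vinj′ (fs (fs fz)) (fs fz) eq = contradiction (sym eq) b≢c
    vinj′ (fs (fs fz)) (fs (fs fz)) _ = refl

module PathWithApex (n : ℕ) where

  G : Graph
  G = PathApex n

  apex : V G
  apex = nothing

  -- Spine vertices and edges are addressed by their number, with an irrelevant bound;
  -- vertexIndex and edgeIndex read the numbers back, and disjointness is argued on them.
  spine : (x : ℕ) → .(x < suc n) → V G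
  spine x x<1+n = just (fromℕ< x<1+n)

  spineEdge : (x : ℕ) → .(x < n) → E G
  spineEdge x x<n = inj₁ (fromℕ< x<n)

  apexEdge : (x : ℕ) → .(x < suc n) → E G
  apexEdge x x<1+n = inj₂ (fromℕ< x<1+n)

  vertexIndex : V G → Maybe ℕ
  vertexIndex = Maybe.map toℕ

  edgeIndex : E G → ℕ ⊎ ℕ
  edgeIndex = Sum.map toℕ toℕ

  vertexIndex-spine : ∀ x .(x<1+n : x < suc n) → vertexIndex (spine x x<1+n) ≡ just x
  vertexIndex-spine _ x<1+n = cong just (toℕ-fromℕ< x<1+n)

  edgeIndex-spineEdge : ∀ x .(x<n : x < n) → edgeIndex (spineEdge x x<n) ≡ inj₁ x
  edgeIndex-spineEdge _ x<n = cong inj₁ (toℕ-fromℕ< x<n)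

  edgeIndex-apexEdge : ∀ x .(x<1+n : x < suc n) → edgeIndex (apexEdge x x<1+n) ≡ inj₂ x
  edgeIndex-apexEdge _ x<1+n = cong inj₂ (toℕ-fromℕ< x<1+n)

  spine-injective : ∀ {x y} .{x<1+n : x < suc n} .{y<1+n : y < suc n} →
                    spine x x<1+n ≡ spine y y<1+n → x ≡ y
  spine-injective {x} {y} {x<1+n} {y<1+n} eq =
    just-injective (images-≡ vertexIndex (vertexIndex-spine x x<1+n) (vertexIndex-spine y y<1+n) eq)

  spine-cong : ∀ {x y} .{x<1+n : x < suc n} .{y<1+n : y < suc n} →
               x ≡ y → spine x x<1+n ≡ spine y y<1+n
  spine-cong refl = refl

  spineEdge-joins : ∀ {x} (x<n : x < n) →
                    Joins G (spineEdge x x<n) (spine x (m<n⇒m<1+n x<n)) (spine (suc x) (s≤s x<n))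
  spineEdge-joins x<n = inj₁ (cong (λ v → just v , just (fs (fromℕ< x<n)))
    (toℕ-injective (trans (toℕ-inject₁ _) (trans (toℕ-fromℕ< x<n) (sym (toℕ-fromℕ< _))))))

  apexEdge-joins : ∀ x .(x<1+n : x < suc n) → Joins G (apexEdge x x<1+n) (spine x x<1+n) apex
  apexEdge-joins _ _ = inj₁ refl

  spineSegment : ∀ x l {y} → l + x ≡ y → (y≤n : y ≤ n) → .(x<1+n : x < suc n) →
                 Path G (spine x x<1+n) (spine y (s≤s y≤n))
  spineSegment x l {y} l+x≡y y≤n _ = record
    { len = l ; vert = vert′ ; edge = edge′ ; start = refl
    ; stop = spine-cong (trans (cong (_+ x) (toℕ-fromℕ l)) l+x≡y)
    ; vinj = λ i j eq → toℕ-injective (+-cancelʳ-≡ x _ _ (spine-injective eq))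
    ; link = link′ }
    where
    t+x≤n : ∀ {t} → t ≤ l → t + x ≤ n
    t+x≤n t≤l = ≤-trans (+-monoˡ-≤ x t≤l) (≤-trans (≤-reflexive l+x≡y) y≤n)
    vert′ : Fin (suc l) → V G
    vert′ i = spine (toℕ i + x) (s≤s (t+x≤n (≤-pred (toℕ<n i))))
    edge′ : Fin l → E G
    edge′ i = spineEdge (toℕ i + x) (t+x≤n (toℕ<n i))
    link′ : ∀ i → Joins G (edge′ i) (vert′ (inject₁ i)) (vert′ (fs i))
    link′ i = subst (λ v → Joins G (edge′ i) v (vert′ (fs i)))
                    (spine-cong (cong (_+ x) (sym (toℕ-inject₁ i))))
                    (spineEdge-joins (t+x≤n (toℕ<n i)))

-- Offset r in block a, i.e. spine vertex 3a + r; written r + a * 3 so that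
-- block a (suc r) reduces to suc (block a r).
block : ℕ → ℕ → ℕ
block a r = r + a * 3

block-injective : ∀ {a b r s} → r < 3 → s < 3 → block a r ≡ block b s → a ≡ b × r ≡ s
block-injective = digits-injective

module Blocks (K n : ℕ) (3K≡1+n : 3 * K ≡ suc n) where
  open PathWithApex n public

  block-< : ∀ {a r} → a < K → r < 3 → block a r < suc n
  block-< {a} {r} a<K r<3 = subst (block a r <_) (trans (*-comm K 3) 3K≡1+n) (digits-< a<K r<3)

module Star (k n : ℕ) (3k≡1+n : 3 * k ≡ suc n) where
  open Blocks k n 3k≡1+n

  H : Graph
  H = S 3 k

  at-< : ∀ (a : Fin k) (r : Fin 3) → block (toℕ a) (toℕ r) < suc n
  at-< a r = block-< (toℕ<n a) (toℕ<n r)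

  spineEdgeAt-< : ∀ (a : Fin k) (r : Fin 2) → block (toℕ a) (toℕ r) < n
  spineEdgeAt-< a r = ≤-pred (block-< (toℕ<n a) (s≤s (toℕ<n r)))

  at : Fin k → Fin 3 → V G
  at a r = spine (block (toℕ a) (toℕ r)) (at-< a r)

  apexEdgeAt : Fin k → Fin 3 → E G
  apexEdgeAt a r = apexEdge (block (toℕ a) (toℕ r)) (at-< a r)

  spineEdgeAt : Fin k → Fin 2 → E G
  spineEdgeAt a r = spineEdge (block (toℕ a) (toℕ r)) (spineEdgeAt-< a r)

  leaf : Fin k → V G
  leaf a = at a (fs fz)

  place : V H → V G
  place nothing = apex
  place (just a) = leaf a

  vertexIndex-at : ∀ a r → vertexIndex (at a r) ≡ just (block (toℕ a) (toℕ r))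
  vertexIndex-at a r = vertexIndex-spine _ (at-< a r)

  edgeIndex-apexEdgeAt : ∀ a r → edgeIndex (apexEdgeAt a r) ≡ inj₂ (block (toℕ a) (toℕ r))
  edgeIndex-apexEdgeAt a r = edgeIndex-apexEdge _ (at-< a r)

  edgeIndex-spineEdgeAt : ∀ a r → edgeIndex (spineEdgeAt a r) ≡ inj₁ (block (toℕ a) (toℕ r))
  edgeIndex-spineEdgeAt a r = edgeIndex-spineEdge _ (spineEdgeAt-< a r)

  leafBlock-injective : ∀ {a b : Fin k} {r s} → r < 3 → s < 3 →
                        block (toℕ a) r ≡ block (toℕ b) s → a ≡ b × r ≡ s
  leafBlock-injective {a} {b} r<3 s<3 eq =
    let a≡b , r≡s = block-injective {toℕ a} {toℕ b} r<3 s<3 eq in toℕ-injective a≡b , r≡s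

  at-injective : ∀ {a b r s} → at a r ≡ at b s → a ≡ b × r ≡ s
  at-injective {a} {b} {r} {s} eq =
    let a≡b , r≡s = leafBlock-injective (toℕ<n r) (toℕ<n s)
                      (just-injective (images-≡ vertexIndex (vertexIndex-at a r) (vertexIndex-at b s) eq))
    in a≡b , toℕ-injective r≡s

  at-≢ : ∀ a r s → r ≢ s → at a r ≢ at a s
  at-≢ a r s r≢s eq = r≢s (proj₂ (at-injective {a} {a} {r} {s} eq))

  apex≢at : ∀ a r → apex ≢ at a r
  apex≢at a r ()

  apexEdgeAt-joins : ∀ a r → Joins G (apexEdgeAt a r) apex (at a r)
  apexEdgeAt-joins a r = swap (apexEdge-joins _ _)

  spineEdgeAt-joins : ∀ a r → Joins G (spineEdgeAt a r) (at a (inject₁ r)) (at a (fs r))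
  spineEdgeAt-joins a fz = spineEdge-joins (spineEdgeAt-< a fz)
  spineEdgeAt-joins a (fs fz) = spineEdge-joins (spineEdgeAt-< a (fs fz))

  leg : (f : E H) → Path G apex (leaf (proj₁ f))
  leg (a , fz) =
    twoEdgePath (at a fz) (apexEdgeAt a fz) (spineEdgeAt a fz)
                (apex≢at a fz) (apex≢at a (fs fz)) (at-≢ a fz (fs fz) (λ ()))
                (apexEdgeAt-joins a fz) (spineEdgeAt-joins a fz)
  leg (a , fs fz) = edgePath (apexEdgeAt a (fs fz)) (apex≢at a (fs fz)) (apexEdgeAt-joins a (fs fz))
  leg (a , fs (fs fz)) =
    twoEdgePath (at a (fs (fs fz))) (apexEdgeAt a (fs (fs fz))) (spineEdgeAt a (fs fz))
                (apex≢at a (fs (fs fz))) (apex≢at a (fs fz)) (at-≢ a (fs (fs fz)) (fs fz) (λ ()))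
                (apexEdgeAt-joins a (fs (fs fz))) (swap (spineEdgeAt-joins a (fs fz)))

  -- The spine edge of leg c joins offsets c and 1 of the block, so it is numbered by the smaller one.
  leg-edge : ∀ a c i →
             edgeIndex (edge (leg (a , c)) i) ≡ inj₂ (block (toℕ a) (toℕ c))
             ⊎ (c ≢ fs fz × edgeIndex (edge (leg (a , c)) i) ≡ inj₁ (block (toℕ a) (toℕ c ⊓ 1)))
  leg-edge a fz fz = inj₁ (edgeIndex-apexEdgeAt a fz)
  leg-edge a fz (fs fz) = inj₂ ((λ ()) , edgeIndex-spineEdgeAt a fz)
  leg-edge a (fs fz) fz = inj₁ (edgeIndex-apexEdgeAt a (fs fz))
  leg-edge a (fs (fs fz)) fz = inj₁ (edgeIndex-apexEdgeAt a (fs (fs fz)))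
  leg-edge a (fs (fs fz)) (fs fz) = inj₂ ((λ ()) , edgeIndex-spineEdgeAt a (fs fz))

  leg-internal : ∀ a c i → Internal (leg (a , c)) i → c ≢ fs fz × vert (leg (a , c)) i ≡ at a c
  leg-internal a c fz (() , _)
  leg-internal a fz (fs fz) _ = (λ ()) , refl
  leg-internal a fz (fs (fs fz)) (_ , s≤s (s≤s ()))
  leg-internal a (fs fz) (fs fz) (_ , s≤s ())
  leg-internal a (fs (fs fz)) (fs fz) _ = (λ ()) , refl
  leg-internal a (fs (fs fz)) (fs (fs fz)) (_ , s≤s (s≤s ()))

  ⊓1<3 : ∀ (c : Fin 3) → toℕ c ⊓ 1 < 3
  ⊓1<3 c = s≤s (≤-trans (m⊓n≤n (toℕ c) 1) (s≤s z≤n))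

  ⊓1-injective : ∀ {c c′ : Fin 3} → c ≢ fs fz → c′ ≢ fs fz →
                 toℕ c ⊓ 1 ≡ toℕ c′ ⊓ 1 → c ≡ c′
  ⊓1-injective {fs fz} c≢1 _ _ = contradiction refl c≢1
  ⊓1-injective {_} {fs fz} _ c′≢1 _ = contradiction refl c′≢1
  ⊓1-injective {fz} {fz} _ _ _ = refl
  ⊓1-injective {fs (fs fz)} {fs (fs fz)} _ _ _ = refl

  place-injective : ∀ x y → place x ≡ place y → x ≡ y
  place-injective nothing nothing _ = refl
  place-injective (just a) (just b) eq = cong just (proj₁ (at-injective {a} {b} {fs fz} {fs fz} eq))

  legs-edge-disjoint : ∀ f f′ → f ≢ f′ → ∀ i j → edge (leg f) i ≢ edge (leg f′) j
  legs-edge-disjoint (a , c) (b , c′) f≢f′ i j eq with leg-edge a c i | leg-edge b c′ j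
  ... | inj₁ e | inj₁ e′ =
    let a≡b , c≡c′ = leafBlock-injective (toℕ<n c) (toℕ<n c′)
                       (inj₂-injective (images-≡ edgeIndex e e′ eq))
    in f≢f′ (cong₂ _,_ a≡b (toℕ-injective c≡c′))
  ... | inj₂ (c≢1 , e) | inj₂ (c′≢1 , e′) =
    let a≡b , c⊓1≡c′⊓1 = leafBlock-injective (⊓1<3 c) (⊓1<3 c′)
                           (inj₁-injective (images-≡ edgeIndex e e′ eq))
    in f≢f′ (cong₂ _,_ a≡b (⊓1-injective c≢1 c′≢1 c⊓1≡c′⊓1))
  ... | inj₁ e | inj₂ (_ , e′) with images-≡ edgeIndex e e′ eq
  ...   | ()
  legs-edge-disjoint (a , c) (b , c′) f≢f′ i j eq | inj₂ (_ , e) | inj₁ e′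
    with images-≡ edgeIndex e e′ eq
  ...   | ()

  legs-avoid-branch-vertices : ∀ f i x → Internal (leg f) i → vert (leg f) i ≢ place x
  legs-avoid-branch-vertices (a , c) i x int eq with leg-internal a c i int
  legs-avoid-branch-vertices (a , c) i nothing int eq | _ , v≡at with trans (sym v≡at) eq
  ... | ()
  legs-avoid-branch-vertices (a , c) i (just b) int eq | c≢1 , v≡at =
    c≢1 (proj₂ (at-injective {a} {b} {c} {fs fz} (trans (sym v≡at) eq)))

  legs-internally-disjoint : ∀ f f′ → f ≢ f′ → ∀ i j →
                             Internal (leg f) i → Internal (leg f′) j → vert (leg f) i ≢ vert (leg f′) j
  legs-internally-disjoint (a , c) (b , c′) f≢f′ i j int int′ eq
    with leg-internal a c i int | leg-internal b c′ j int′
  ... | _ , v≡at | _ , v′≡at′ =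
    let a≡b , c≡c′ = at-injective {a} {b} {c} {c′} (trans (sym v≡at) (trans eq v′≡at′))
    in f≢f′ (cong₂ _,_ a≡b c≡c′)

  subdivision : Subdivision H G
  subdivision = record
    { system = record { φ = place ; φ-inj = place-injective ; path = leg
                      ; edisj = legs-edge-disjoint ; avoid = legs-avoid-branch-vertices }
    ; idisj = legs-internally-disjoint }

%2-alternates : ∀ m → suc m % 2 ≢ m % 2
%2-alternates (suc (suc m)) eq = %2-alternates m eq

vkeep-alternates : ∀ i j → T (vkeep i j) → ¬ T (vkeep (suc i) j)
vkeep-alternates i j keep keep′ =
  %2-alternates i (trans (sym (≡ᵇ⇒≡ (j % 2) _ keep′)) (≡ᵇ⇒≡ (j % 2) _ keep))

pred-< : ∀ {m N} → 0 < m → m ≤ N → pred m < N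
pred-< (s≤s _) m≤N = m≤N

module WallGeometry (ℓ : ℕ) where

  InGrid : ℕ × ℕ → Set
  InGrid (i , j) = (0 < i × i ≤ ℓ) × (0 < j × j ≤ 2 * ℓ)

  vertex-in-grid : ∀ (p : WV ℓ) → InGrid (proj₁ p)
  vertex-in-grid ((i , j) , t) =
    let grid , _ = Equivalence.to T-∧ t
        1≤i , rest = Equivalence.to T-∧ grid
        i≤ℓ , rest′ = Equivalence.to T-∧ rest
        1≤j , j≤2ℓ = Equivalence.to T-∧ rest′
    in (≤ᵇ⇒≤ 1 i 1≤i , ≤ᵇ⇒≤ i ℓ i≤ℓ)
     , (≤ᵇ⇒≤ 1 j 1≤j , ≤ᵇ⇒≤ j (2 * ℓ) j≤2ℓ)

  WV-≡ : ∀ {p q : WV ℓ} → proj₁ p ≡ proj₁ q → p ≡ q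
  WV-≡ {_ , t} {_ , t′} refl = cong (_ ,_) (T-irrelevant t t′)

  row column : WV ℓ → ℕ
  row p = proj₁ (proj₁ p)
  column p = proj₂ (proj₁ p)

  -- WAdj p q unfolds to HorizontalStep p q ⊎ VerticalStep p q.
  HorizontalStep VerticalStep : WV ℓ → WV ℓ → Set
  HorizontalStep p q = row q ≡ row p × column q ≡ suc (column p)
  VerticalStep p q = row q ≡ suc (row p) × column q ≡ column p × T (vkeep (row p) (column p))

  horizontalStep-unique : ∀ {p q q′} → HorizontalStep p q → HorizontalStep p q′ → q ≡ q′
  horizontalStep-unique (refl , refl) (refl , refl) = WV-≡ refl

  verticalStep-unique-target : ∀ {p q q′} → VerticalStep p q → VerticalStep p q′ → q ≡ q′
  verticalStep-unique-target (refl , refl , _) (refl , refl , _) = WV-≡ refl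

  verticalStep-unique-source : ∀ {p p′ q} → VerticalStep p q → VerticalStep p′ q → p ≡ p′
  verticalStep-unique-source {(_ , _) , _} {(_ , _) , _} (refl , refl , _) (refl , refl , _) = WV-≡ refl

  verticalStep-≢ : ∀ {p q} → VerticalStep p q → p ≢ q
  verticalStep-≢ (q-row , _) p≡q = 1+n≢n (trans (sym q-row) (cong row (sym p≡q)))

  verticalSteps-do-not-chain : ∀ {p q r} → VerticalStep p q → ¬ VerticalStep q r
  verticalSteps-do-not-chain {p} (refl , refl , keep) (_ , _ , keep′) =
    vkeep-alternates (row p) (column p) keep keep′

  WAdj-irrelevant : ∀ {p q : WV ℓ} (a b : WAdj p q) → a ≡ b
  WAdj-irrelevant (inj₁ (refl , refl)) (inj₁ (refl , refl)) = refl
  WAdj-irrelevant (inj₁ (refl , refl)) (inj₂ (_ , () , _))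
  WAdj-irrelevant (inj₂ (refl , refl , _)) (inj₁ (_ , ()))
  WAdj-irrelevant (inj₂ (refl , refl , keep)) (inj₂ (refl , refl , keep′)) =
    cong (λ k → inj₂ (refl , refl , k)) (T-irrelevant keep keep′)

  wallEdge-≡ : ∀ {f f′ : E (Wall ℓ)} → proj₁ f ≡ proj₁ f′ → f ≡ f′
  wallEdge-≡ {(p , q) , a} {_ , a′} refl = cong ((p , q) ,_) (WAdj-irrelevant {p} {q} a a′)

  wallIndex : WV ℓ → ℕ
  wallIndex ((i , j) , _) = pred j + pred i * (2 * ℓ)

  wallIndex-< : ∀ p → wallIndex p < ℓ * (2 * ℓ)
  wallIndex-< ((i , j) , t) =
    let (0<i , i≤ℓ) , (0<j , j≤2ℓ) = vertex-in-grid ((i , j) , t)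
    in digits-< (pred-< 0<i i≤ℓ) (pred-< 0<j j≤2ℓ)

  wallIndex-injective : ∀ {p q} → wallIndex p ≡ wallIndex q → p ≡ q
  wallIndex-injective {(i , j) , t} {(i′ , j′) , t′} eq =
    let (0<i , _) , (0<j , j≤2ℓ) = vertex-in-grid ((i , j) , t)
        (0<i′ , _) , (0<j′ , j′≤2ℓ) = vertex-in-grid ((i′ , j′) , t′)
        i≡ , j≡ = digits-injective (pred-< 0<j j≤2ℓ) (pred-< 0<j′ j′≤2ℓ) eq
    in WV-≡ (cong₂ _,_ (pred-injective {{>-nonZero 0<i}} {{>-nonZero 0<i′}} i≡)
                       (pred-injective {{>-nonZero 0<j}} {{>-nonZero 0<j′}} j≡))

  wallIndex-horizontalStep : ∀ {p q} → HorizontalStep p q → wallIndex q ≡ suc (wallIndex p)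
  wallIndex-horizontalStep {p@((i , j) , _)} (refl , refl) =
    cong (_+ pred i * (2 * ℓ)) (sym (suc-pred j {{>-nonZero (proj₁ (proj₂ (vertex-in-grid p)))}}))

module WallEmbedding (ℓ n : ℕ) (3L≡1+n : 3 * (ℓ * (2 * ℓ)) ≡ suc n) where
  open WallGeometry ℓ
  open Blocks (ℓ * (2 * ℓ)) n 3L≡1+n

  W : Graph
  W = Wall ℓ

  1<3 : 1 < 3
  1<3 = s≤s (s≤s z≤n)

  branch-< : ∀ p → block (wallIndex p) 1 < suc n
  branch-< p = block-< (wallIndex-< p) 1<3

  branch : WV ℓ → V G
  branch p = spine (block (wallIndex p) 1) (branch-< p)

  branchEdge : WV ℓ → E G
  branchEdge p = apexEdge (block (wallIndex p) 1) (branch-< p)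

  branchEdge-joins : ∀ p → Joins G (branchEdge p) (branch p) apex
  branchEdge-joins p = apexEdge-joins (block (wallIndex p) 1) (branch-< p)

  vertexIndex-branch : ∀ p → vertexIndex (branch p) ≡ just (block (wallIndex p) 1)
  vertexIndex-branch p = vertexIndex-spine (block (wallIndex p) 1) (branch-< p)

  edgeIndex-branchEdge : ∀ p → edgeIndex (branchEdge p) ≡ inj₂ (block (wallIndex p) 1)
  edgeIndex-branchEdge p = edgeIndex-apexEdge (block (wallIndex p) 1) (branch-< p)

  branch≢apex : ∀ p → branch p ≢ apex
  branch≢apex p ()

  branch-injective : ∀ {p q} → branch p ≡ branch q → p ≡ q
  branch-injective {p} {q} eq =
    wallIndex-injective (proj₁ (block-injective {wallIndex p} {wallIndex q} 1<3 1<3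
      (just-injective (images-≡ vertexIndex (vertexIndex-branch p) (vertexIndex-branch q) eq))))

  branchEdge-injective : ∀ {p q} → branchEdge p ≡ branchEdge q → p ≡ q
  branchEdge-injective {p} {q} eq =
    wallIndex-injective (proj₁ (block-injective {wallIndex p} {wallIndex q} 1<3 1<3
      (inj₂-injective (images-≡ edgeIndex (edgeIndex-branchEdge p) (edgeIndex-branchEdge q) eq))))

  horizontalPath : ∀ p q → HorizontalStep p q → Path G (branch p) (branch q)
  horizontalPath p q step =
    spineSegment (block (wallIndex p) 1) 3
                 (cong (λ d → block d 1) (sym (wallIndex-horizontalStep {p} {q} step)))
                 (≤-pred (branch-< q)) (branch-< p)

  verticalPath : ∀ p q → p ≢ q → Path G (branch p) (branch q)
  verticalPath p q p≢q =
    twoEdgePath apex (branchEdge p) (branchEdge q) (branch≢apex p) (p≢q ∘ branch-injective)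
                (branch≢apex q ∘ sym) (branchEdge-joins p) (swap (branchEdge-joins q))

  wallPath : (f : E W) → Path G (branch (proj₁ (proj₁ f))) (branch (proj₂ (proj₁ f)))
  wallPath ((p , q) , inj₁ step) = horizontalPath p q step
  wallPath ((p , q) , inj₂ step) = verticalPath p q (verticalStep-≢ {p} {q} step)

  horizontalPath-edge : ∀ p q step k → edgeIndex (edge (horizontalPath p q step) k)
                                          ≡ inj₁ (suc (block (wallIndex p) (toℕ k)))
  horizontalPath-edge p q step k =
    trans (edgeIndex-spineEdge (toℕ k + block (wallIndex p) 1) _) (cong inj₁ (+-suc (toℕ k) _))

  horizontalPath-vert : ∀ p q step k → vertexIndex (vert (horizontalPath p q step) k)
                                          ≡ just (suc (block (wallIndex p) (toℕ k)))
  horizontalPath-vert p q step k =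
    trans (vertexIndex-spine (toℕ k + block (wallIndex p) 1) _) (cong just (+-suc (toℕ k) _))

  horizontalPaths-share-edge⇒same-tail : ∀ p q step k p′ q′ step′ k′ →
    edge (horizontalPath p q step) k ≡ edge (horizontalPath p′ q′ step′) k′ → p ≡ p′
  horizontalPaths-share-edge⇒same-tail p q step k p′ q′ step′ k′ eq =
    wallIndex-injective (proj₁ (block-injective {wallIndex p} {wallIndex p′} (toℕ<n k) (toℕ<n k′)
      (suc-injective (inj₁-injective
        (images-≡ edgeIndex (horizontalPath-edge p q step k)
                            (horizontalPath-edge p′ q′ step′ k′) eq)))))

  horizontalPath-edge≢branchEdge : ∀ p q step k x → edge (horizontalPath p q step) k ≢ branchEdge x
  horizontalPath-edge≢branchEdge p q step k x eq
    with images-≡ edgeIndex (horizontalPath-edge p q step k) (edgeIndex-branchEdge x) eq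
  ... | ()

  horizontalPath-avoids : ∀ p q step k x → Internal (horizontalPath p q step) k →
                          vert (horizontalPath p q step) k ≢ branch x
  horizontalPath-avoids p q step k x (0<k , k<3) eq = <⇒≢ 0<k (sym k≡0)
    where
    k≡0 : toℕ k ≡ 0
    k≡0 = proj₂ (block-injective {wallIndex p} {wallIndex x} k<3 (s≤s z≤n)
            (suc-injective (just-injective
              (images-≡ vertexIndex (horizontalPath-vert p q step k) (vertexIndex-branch x) eq))))

  wallPaths-edge-disjoint : ∀ f f′ → f ≢ f′ → ∀ k k′ →
                            edge (wallPath f) k ≢ edge (wallPath f′) k′
  wallPaths-edge-disjoint ((p , q) , inj₁ h) ((p′ , q′) , inj₁ h′) f≢f′ k k′ eq
    with horizontalPaths-share-edge⇒same-tail p q h k p′ q′ h′ k′ eq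
  ... | refl = f≢f′ (wallEdge-≡ (cong (p ,_) (horizontalStep-unique {p} {q} {q′} h h′)))
  wallPaths-edge-disjoint ((p , q) , inj₁ h) ((p′ , q′) , inj₂ _) _ k fz =
    horizontalPath-edge≢branchEdge p q h k p′
  wallPaths-edge-disjoint ((p , q) , inj₁ h) ((p′ , q′) , inj₂ _) _ k (fs fz) =
    horizontalPath-edge≢branchEdge p q h k q′
  wallPaths-edge-disjoint ((p , q) , inj₂ _) ((p′ , q′) , inj₁ h′) _ fz k′ =
    horizontalPath-edge≢branchEdge p′ q′ h′ k′ p ∘ sym
  wallPaths-edge-disjoint ((p , q) , inj₂ _) ((p′ , q′) , inj₁ h′) _ (fs fz) k′ =
    horizontalPath-edge≢branchEdge p′ q′ h′ k′ q ∘ sym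
  wallPaths-edge-disjoint ((p , q) , inj₂ v) ((p′ , q′) , inj₂ v′) f≢f′ fz fz eq
    with branchEdge-injective {p} {p′} eq
  ... | refl = f≢f′ (wallEdge-≡ (cong (p ,_) (verticalStep-unique-target {p} {q} {q′} v v′)))
  wallPaths-edge-disjoint ((p , q) , inj₂ v) ((p′ , q′) , inj₂ v′) f≢f′ (fs fz) (fs fz) eq
    with branchEdge-injective {q} {q′} eq
  ... | refl = f≢f′ (wallEdge-≡ (cong (_, q) (verticalStep-unique-source {p} {p′} {q} v v′)))
  wallPaths-edge-disjoint ((p , q) , inj₂ v) ((p′ , q′) , inj₂ v′) _ fz (fs fz) eq
    with branchEdge-injective {p} {q′} eq
  ... | refl = verticalSteps-do-not-chain {p′} {p} {q} v′ v
  wallPaths-edge-disjoint ((p , q) , inj₂ v) ((p′ , q′) , inj₂ v′) _ (fs fz) fz eq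
    with branchEdge-injective {q} {p′} eq
  ... | refl = verticalSteps-do-not-chain {p} {q} {q′} v v′

  wallPaths-avoid-branch-vertices : ∀ f k x → Internal (wallPath f) k →
                                    vert (wallPath f) k ≢ branch x
  wallPaths-avoid-branch-vertices ((p , q) , inj₁ h) k x = horizontalPath-avoids p q h k x
  wallPaths-avoid-branch-vertices ((p , q) , inj₂ _) fz x (() , _)
  wallPaths-avoid-branch-vertices ((p , q) , inj₂ _) (fs fz) x _ = branch≢apex x ∘ sym
  wallPaths-avoid-branch-vertices ((p , q) , inj₂ _) (fs (fs fz)) x (_ , s≤s (s≤s ()))

  immersion : StrongImmersion W G
  immersion = record { φ = branch ; φ-inj = λ _ _ → branch-injective ; path = wallPath
                     ; edisj = wallPaths-edge-disjoint ; avoid = wallPaths-avoid-branch-vertices }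

wall-size : ∀ ℓ → 3 * (ℓ * (2 * ℓ)) ≡ 6 * (ℓ * ℓ)
wall-size = solve-∀

lemma4p5 : ((k : ℕ) → 0 < k → Subdivision (S 3 k) (PathApex (3 * k ∸ 1)))
           × ((ℓ : ℕ) → 0 < ℓ → StrongImmersion (Wall ℓ) (PathApex (6 * (ℓ * ℓ) ∸ 1)))
lemma4p5 = star , wall
  where
  star : (k : ℕ) → 0 < k → Subdivision (S 3 k) (PathApex (3 * k ∸ 1))
  star k@(suc _) _ = Star.subdivision k (3 * k ∸ 1) refl

  wall : (ℓ : ℕ) → 0 < ℓ → StrongImmersion (Wall ℓ) (PathApex (6 * (ℓ * ℓ) ∸ 1))
  wall ℓ@(suc _) _ = WallEmbedding.immersion ℓ (6 * (ℓ * ℓ) ∸ 1) (wall-size ℓ)
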